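{- Let $H=(V,E)$ be a hypergraph such that the digraph $D_3(H)$ has a spanning subdigraph that is a vertex-disjoint union of non-trivial arborescences. Then $H$ is quasi-eulerian.
   Context: A hypergraph $H=(V,E)$ has a nonempty finite vertex set $V$ and a finite set $E$ of edges, each associated with a subset of $V$ (parallel edges allowed); hypergraphs are assumed to have no empty edges. $D_3(H)$ is the digraph with vertex set $E$ and arc set $\{(e,f): e,f\in E,\ |f\setminus e|=1,\ |e\cap f|\ge 3\}$. An arborescence is a digraph whose underlying undirected graph is a tree and whose arcs are all directed towards a root; it is non-trivial if it has at least two vertices. A walk is $v_0e_1v_1\dots e_kv_k$ with $v_{i-1}\ne v_i$, $v_{i-1},v_i\in e_i$; anchors $v_0,\dots,v_k$; closed if $k\ge2$, $v_0=v_k$; a strict trail if $e_1,\dots,e_k$ are pairwise distinct. An Euler family is a family of pairwise anchor-disjoint closed strict trails such that each edge of $H$ lies in exactly one of them; $H$ is quasi-eulerian if it admits one. -}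

module Defs where

open import Data.Nat using (ℕ; zero; suc; _≤_)
open import Data.Fin using (Fin; zero; suc; inject₁; fromℕ)
open import Data.Fin.Subset using (Subset; _∈_; _─_; _∩_; ∣_∣; Nonempty)
open import Data.Product using (Σ; ∃; _×_; _,_)
open import Data.Sum using (_⊎_)
open import Relation.Binary.PropositionalEquality using (_≡_; _≢_)
open import Relation.Nullary using (¬_)
open import Data.Bool using (Bool; T)

-- A hypergraph with vertex set Fin nV (nonempty) and edge set Fin nE
-- (parallel edges allowed: `edge` need not be injective); no empty edges.
record Hypergraph : Set where
  field
    nV        : ℕ
    nE        : ℕ
    edge      : Fin nE → Subset nV
    V-nonempty : Fin nV
    E-nonempty : ∀ e → Nonempty (edge e)

module _ (H : Hypergraph) where
  open Hypergraph H

  D₃-arc : Fin nE → Fin nE → Set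
  D₃-arc e f = (∣ edge f ─ edge e ∣ ≡ 1) × (3 ≤ ∣ edge e ∩ edge f ∣)

  data Path⁺ (A : Fin nE → Fin nE → Set) : Fin nE → Fin nE → Set where
    [_]  : ∀ {x y} → A x y → Path⁺ A x y
    _∷_  : ∀ {x y z} → A x y → Path⁺ A y z → Path⁺ A x z

  -- (The arc set is given as a decidable (Bool-valued) relation; every
  --  subdigraph of a finite digraph is decidable classically.)
  -- A spanning subdigraph of D₃(H) (arc set A ⊆ arcs of D₃(H), all vertices
  -- kept) that is a vertex-disjoint union of non-trivial arborescences
  -- (all arcs directed towards the roots).  For a finite digraph this is:
  --   * every vertex has out-degree ≤ 1 (the root of its component has 0),
  --   * there is no directed cycle,
  --   * every vertex is incident with some arc (each component, i.e. each
  --     arborescence, has at least two vertices).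
  record SpanningArborescenceForest : Set where
    field
      arc         : Fin nE → Fin nE → Bool
      arc⊆D₃      : ∀ {e f} → T (arc e f) → D₃-arc e f
      outdeg≤1    : ∀ {e f g} → T (arc e f) → T (arc e g) → f ≡ g
      acyclic     : ∀ e → ¬ Path⁺ (λ x y → T (arc x y)) e e
      nontrivial  : ∀ e → (∃ λ f → T (arc e f)) ⊎ (∃ λ f → T (arc f e))

  -- Closed strict trails  v₀ e₁ v₁ … e_k v_k  with v_k = v₀, k ≥ 2.
  -- Anchors are v (Fin (suc k)), edges are es (Fin k); the i-th edge
  -- es i joins anchor v (inject₁ i) and anchor v (suc i).

  record ClosedStrictTrail : Set where
    field
      len      : ℕ
      len≥2    : 2 ≤ len
      anchor   : Fin (suc len) → Fin nV
      edgeAt   : Fin len → Fin nE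
      step≢    : ∀ i → anchor (inject₁ i) ≢ anchor (suc i)
      step∈₁   : ∀ i → anchor (inject₁ i) ∈ edge (edgeAt i)
      step∈₂   : ∀ i → anchor (suc i) ∈ edge (edgeAt i)
      closed   : anchor (fromℕ len) ≡ anchor zero
      strict   : ∀ i j → edgeAt i ≡ edgeAt j → i ≡ j

  open ClosedStrictTrail

  _∈ᵉ_ : Fin nE → ClosedStrictTrail → Set
  f ∈ᵉ T = ∃ λ i → edgeAt T i ≡ f

  record EulerFamily : Set where
    field
      size          : ℕ
      trail         : Fin size → ClosedStrictTrail
      anchorDisjoint : ∀ a b → a ≢ b → ∀ i j →
                       anchor (trail a) i ≢ anchor (trail b) j
      covers        : ∀ f → ∃ λ a → f ∈ᵉ trail a
      unique        : ∀ f a b → f ∈ᵉ trail a → f ∈ᵉ trail b → a ≡ b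

  QuasiEulerian : Set
  QuasiEulerian = EulerFamily

{-# OPTIONS --safe #-}

-- For an arc (e, f) of D₃(H), e ∩ f has at least three vertices and at most one vertex of f
-- lies outside e. So two vertices of e ∩ f carry a closed strict trail through f and e (a
-- digon), and any step u –f– w of a trail can be replaced by u –e– x –f– w or u –f– x –e– w,
-- where x ∈ e ∩ f avoids u and w and one of u, w lies in e: a child can always be absorbed
-- into the trail of its parent. Covering every root by a digon with one of its children, and
-- then every other edge by absorption next to its parent (or by a digon with its parent, if
-- that is still uncovered), splits E into closed strict trails. Splicing trails that share an
-- anchor at that anchor finally makes them pairwise anchor-disjoint.

module Submission where

open import Defs
open import Data.Nat using (ℕ; zero; suc; _≤_; _<_; z≤n; s≤s)
open import Data.Nat.Properties using (≤-trans; ≤-pred; m≤n⇒m≤1+n; <-irrefl)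
open import Data.Fin using (Fin; zero; suc; inject₁; fromℕ; _≟_)
open import Data.Fin.Properties using (any?)
open import Data.Vec.Base using ([]; _∷_; here; there)
open import Data.Fin.Subset using (Subset; _∈_; _─_; _∩_; ∣_∣; ⁅_⁆; inside; outside)
open import Data.Fin.Subset.Properties
  using (_∈?_; ∣⁅x⁆∣≡1; x∈⁅y⁆⇒x≡y; x≢y⇒x∉⁅y⁆; p⊆q⇒∣p∣≤∣q∣; x∈p⇒∣p-x∣<∣p∣; x∈p∩q⁻; x∈p∧x∉q⇒x∈p─q)
open import Data.List using (List; []; _∷_; _++_; length; lookup; concat; concatMap; map; allFin)
open import Data.List.Properties using (length-++-≤ˡ; ++-assoc)
open import Data.List.Relation.Unary.Any as Any using (Any; here; there)
import Data.List.Relation.Unary.Any.Properties as Any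
open import Data.List.Relation.Unary.All as All using (All; []; _∷_)
import Data.List.Relation.Unary.All.Properties as All
open import Data.List.Relation.Unary.AllPairs as AllPairs using (AllPairs; []; _∷_)
import Data.List.Relation.Unary.AllPairs.Properties as AllPairs
open import Data.List.Relation.Unary.Unique.Propositional using (Unique)
open import Data.List.Relation.Binary.Disjoint.Propositional using (Disjoint)
import Data.List.Relation.Binary.Disjoint.Propositional.Properties as Disjoint
open import Data.List.Membership.Propositional using (find; lose) renaming (_∈_ to _∈ₗ_; _∉_ to _∉ₗ_)
open import Data.List.Membership.Propositional.Properties using (∈-allFin; ∈-lookup; ∈-++⁻; ∈-++⁺ˡ; ∈-++⁺ʳ; ∈-concat⁺′)
import Data.List.Membership.DecPropositional as DecMembership
open import Data.List.Relation.Binary.Permutation.Propositional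
  using (_↭_; ↭-refl; ↭-sym; ↭-trans; ↭-prep; ↭-swap; ↭-reflexive; ↭⇒↭ₛ; module PermutationReasoning)
open import Data.List.Relation.Binary.Permutation.Propositional.Properties as ↭
  using (∈-resp-↭; ↭-length; ++-comm; shifts)
import Data.List.Relation.Binary.Permutation.Setoid.Properties as ↭ₛ
open import Data.Product using (Σ; ∃; ∃₂; _×_; _,_; proj₁; proj₂)
open import Data.Sum using (_⊎_; inj₁; inj₂)
open import Data.Bool using (T)
open import Data.Unit using (⊤; tt)
open import Function using (_∘_; id; const)
open import Relation.Nullary using (¬_; Dec; yes; no; contradiction)
open import Relation.Nullary.Decidable using (T?)
open import Relation.Unary using (_⊆_)
open import Relation.Binary using (Rel; Symmetric; _Respects_)
open import Relation.Binary.PropositionalEquality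
  using (_≡_; _≢_; refl; sym; cong; subst; ≢-sym; resp₂; setoid)

module _ {n : ℕ} where

  x∈p⇒0<∣p∣ : ∀ {p : Subset n} {x} → x ∈ p → 0 < ∣ p ∣
  x∈p⇒0<∣p∣ {p} {x} x∈p = subst (_≤ ∣ p ∣) (∣⁅x⁆∣≡1 x) (p⊆q⇒∣p∣≤∣q∣ ⁅x⁆⊆p)
    where
      ⁅x⁆⊆p : ∀ {y} → y ∈ ⁅ x ⁆ → y ∈ p
      ⁅x⁆⊆p y∈⁅x⁆ = subst (_∈ p) (sym (x∈⁅y⁆⇒x≡y x y∈⁅x⁆)) x∈p

  x∈p∧y∈p∧x≢y⇒1<∣p∣ : ∀ {p : Subset n} {x y} → x ∈ p → y ∈ p → x ≢ y → 1 < ∣ p ∣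
  x∈p∧y∈p∧x≢y⇒1<∣p∣ x∈p y∈p x≢y =
    ≤-trans (s≤s (x∈p⇒0<∣p∣ (x∈p∧x∉q⇒x∈p─q y∈p (x≢y⇒x∉⁅y⁆ (≢-sym x≢y))))) (x∈p⇒∣p-x∣<∣p∣ x∈p)

  ∣p∣≡1⇒x≡y : ∀ {p : Subset n} {x y} → ∣ p ∣ ≡ 1 → x ∈ p → y ∈ p → x ≡ y
  ∣p∣≡1⇒x≡y {x = x} {y} ∣p∣≡1 x∈p y∈p with x ≟ y
  ... | yes x≡y = x≡y
  ... | no x≢y = contradiction (subst (1 <_) ∣p∣≡1 (x∈p∧y∈p∧x≢y⇒1<∣p∣ x∈p y∈p x≢y)) (<-irrefl refl)

  ∣q─p∣≡1⇒x∈p⊎y∈p : ∀ {p q : Subset n} {x y} → ∣ q ─ p ∣ ≡ 1 → x ≢ y → x ∈ q → y ∈ q → x ∈ p ⊎ y ∈ p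
  ∣q─p∣≡1⇒x∈p⊎y∈p {p} {x = x} {y} ∣q─p∣≡1 x≢y x∈q y∈q with x ∈? p | y ∈? p
  ... | yes x∈p | _       = inj₁ x∈p
  ... | no _    | yes y∈p = inj₂ y∈p
  ... | no x∉p  | no y∉p  =
    contradiction (∣p∣≡1⇒x≡y ∣q─p∣≡1 (x∈p∧x∉q⇒x∈p─q x∈q x∉p) (x∈p∧x∉q⇒x∈p─q y∈q y∉p)) x≢y

private
  dropZero : ∀ {n} → List (Fin (suc n)) → List (Fin n)
  dropZero []           = []
  dropZero (zero ∷ xs)  = dropZero xs
  dropZero (suc x ∷ xs) = x ∷ dropZero xs

  length-dropZero : ∀ {n} (xs : List (Fin (suc n))) → length (dropZero xs) ≤ length xs
  length-dropZero []           = z≤n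
  length-dropZero (zero ∷ xs)  = m≤n⇒m≤1+n (length-dropZero xs)
  length-dropZero (suc x ∷ xs) = s≤s (length-dropZero xs)

  zero∈⇒length-dropZero< : ∀ {n} (xs : List (Fin (suc n))) → zero ∈ₗ xs → length (dropZero xs) < length xs
  zero∈⇒length-dropZero< (zero ∷ xs)  _          = s≤s (length-dropZero xs)
  zero∈⇒length-dropZero< (suc x ∷ xs) (there p) = s≤s (zero∈⇒length-dropZero< xs p)

  suc∈⇒∈dropZero : ∀ {n} {x : Fin n} (xs : List (Fin (suc n))) → suc x ∈ₗ xs → x ∈ₗ dropZero xs
  suc∈⇒∈dropZero (zero ∷ xs)  (there p)   = suc∈⇒∈dropZero xs p
  suc∈⇒∈dropZero (suc y ∷ xs) (here refl) = here refl
  suc∈⇒∈dropZero (suc y ∷ xs) (there p)   = there (suc∈⇒∈dropZero xs p)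

length<∣p∣⇒∃x∈p∉xs : ∀ {n} (p : Subset n) (xs : List (Fin n)) → length xs < ∣ p ∣ → ∃ λ x → x ∈ p × x ∉ₗ xs
length<∣p∣⇒∃x∈p∉xs []            xs ()
length<∣p∣⇒∃x∈p∉xs (outside ∷ p) xs <∣p∣
  with x , x∈p , x∉ ← length<∣p∣⇒∃x∈p∉xs p (dropZero xs) (≤-trans (s≤s (length-dropZero xs)) <∣p∣)
  = suc x , there x∈p , x∉ ∘ suc∈⇒∈dropZero xs
length<∣p∣⇒∃x∈p∉xs (inside ∷ p) xs <∣p∣ with DecMembership._∈?_ _≟_ zero xs
... | no zero∉ = zero , here , zero∉
... | yes zero∈
  with x , x∈p , x∉ ← length<∣p∣⇒∃x∈p∉xs p (dropZero xs) (≤-trans (zero∈⇒length-dropZero< xs zero∈) (≤-pred <∣p∣))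
  = suc x , there x∈p , x∉ ∘ suc∈⇒∈dropZero xs

module _ {a} {A : Set a} where

  Unique-resp-↭ : Unique {A = A} Respects _↭_
  Unique-resp-↭ = ↭ₛ.AllPairs-resp-↭ (setoid A) ≢-sym (resp₂ _≢_) ∘ ↭⇒↭ₛ

  ↭-expand : ∀ (ts ss : List A) {ms js rest} → ms ↭ js ++ rest → js ↭ ts ++ ss → ms ↭ ts ++ (ss ++ rest)
  ↭-expand ts ss {rest = rest} ms↭ js↭ =
    ↭-trans ms↭ (↭-trans (↭.++⁺ʳ rest js↭) (↭-reflexive (++-assoc ts ss rest)))

  Disjoint-resp-↭ʳ : ∀ {xs ys zs : List A} → ys ↭ zs → Disjoint xs ys → Disjoint xs zs
  Disjoint-resp-↭ʳ ys↭zs xs#ys (v∈xs , v∈zs) = xs#ys (v∈xs , ∈-resp-↭ (↭-sym ys↭zs) v∈zs)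

  Disjoint-++⁺ʳ : ∀ {xs : List A} ys {zs} → Disjoint xs ys → Disjoint xs zs → Disjoint xs (ys ++ zs)
  Disjoint-++⁺ʳ ys xs#ys xs#zs (v∈xs , v∈ys++zs) with ∈-++⁻ ys v∈ys++zs
  ... | inj₁ v∈ys = xs#ys (v∈xs , v∈ys)
  ... | inj₂ v∈zs = xs#zs (v∈xs , v∈zs)

  Disjoint-concat⁻ʳ : ∀ {vs : List A} {xss} → Disjoint vs (concat xss) → All (Disjoint vs) xss
  Disjoint-concat⁻ʳ vs#xss = All.tabulate λ xs∈xss (v∈vs , v∈xs) → vs#xss (v∈vs , ∈-concat⁺′ v∈xs xs∈xss)

  Unique-++⁻ : ∀ (xs : List A) {ys} → Unique (xs ++ ys) → Unique xs × Unique ys × Disjoint xs ys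
  Unique-++⁻ []       u            = [] , u , λ ()
  Unique-++⁻ (x ∷ xs) (x∉ ∷ u) with uxs , uys , xs#ys ← Unique-++⁻ xs u =
    All.++⁻ˡ xs x∉ ∷ uxs , uys , λ where
      (here refl , x∈ys)  → All.lookup (All.++⁻ʳ xs x∉) x∈ys refl
      (there v∈xs , v∈ys) → xs#ys (v∈xs , v∈ys)

  Unique-concat⁻ : ∀ (xss : List (List A)) → Unique (concat xss) → All Unique xss × AllPairs Disjoint xss
  Unique-concat⁻ []         _ = [] , []
  Unique-concat⁻ (xs ∷ xss) u with uxs , urest , xs#rest ← Unique-++⁻ xs u
    with us , ds ← Unique-concat⁻ xss urest
    = uxs ∷ us , Disjoint-concat⁻ʳ xs#rest ∷ ds

  AllPairs-lookup : ∀ {ℓ} {R : Rel A ℓ} {xs} → Symmetric R → AllPairs R xs →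
                    ∀ {i j} → i ≢ j → R (lookup xs i) (lookup xs j)
  AllPairs-lookup sym-R (r ∷ rs) {zero}  {zero}  i≢j = contradiction refl i≢j
  AllPairs-lookup sym-R (r ∷ rs) {zero}  {suc j} _   = All.lookup r (∈-lookup j)
  AllPairs-lookup sym-R (r ∷ rs) {suc i} {zero}  _   = sym-R (All.lookup r (∈-lookup i))
  AllPairs-lookup sym-R (r ∷ rs) {suc i} {suc j} i≢j = AllPairs-lookup sym-R rs (i≢j ∘ cong suc)

  Unique⇒lookup-injective : ∀ {xs : List A} → Unique xs → ∀ {i j} → lookup xs i ≡ lookup xs j → i ≡ j
  Unique⇒lookup-injective u {i} {j} eq with i ≟ j
  ... | yes i≡j = i≡j
  ... | no i≢j  = contradiction eq (AllPairs-lookup ≢-sym u i≢j)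

  ∈⇒∃lookup : ∀ {x} {xs : List A} → x ∈ₗ xs → ∃ λ i → lookup xs i ≡ x
  ∈⇒∃lookup x∈xs = Any.index x∈xs , sym (Any.lookup-index x∈xs)

-- Walks, closed walks and their splicing

module Walks (H : Hypergraph) where
  open Hypergraph H

  Vertex : Set
  Vertex = Fin nV

  Edge : Set
  Edge = Fin nE

  Step : Edge → Vertex → Vertex → Set
  Step e u w = u ≢ w × u ∈ edge e × w ∈ edge e

  infixr 5 _++ʷ_

  data Walk : Vertex → Vertex → Set where
    []   : ∀ {u} → Walk u u
    step : ∀ {u w v} e → Step e u w → Walk w v → Walk u v

  edges : ∀ {u v} → Walk u v → List Edge
  edges []           = []
  edges (step e _ W) = e ∷ edges W

  -- The final vertex is not listed, so that anchors (A ++ʷ B) = anchors A ++ anchors B.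
  anchors : ∀ {u v} → Walk u v → List Vertex
  anchors []               = []
  anchors (step {u} _ _ W) = u ∷ anchors W

  _++ʷ_ : ∀ {u m v} → Walk u m → Walk m v → Walk u v
  []         ++ʷ B = B
  step e s A ++ʷ B = step e s (A ++ʷ B)

  edges-++ʷ : ∀ {u m v} (A : Walk u m) (B : Walk m v) → edges (A ++ʷ B) ≡ edges A ++ edges B
  edges-++ʷ []           B = refl
  edges-++ʷ (step e s A) B = cong (e ∷_) (edges-++ʷ A B)

  anchors-++ʷ : ∀ {u m v} (A : Walk u m) (B : Walk m v) → anchors (A ++ʷ B) ≡ anchors A ++ anchors B
  anchors-++ʷ []               B = refl
  anchors-++ʷ (step {u} e s A) B = cong (u ∷_) (anchors-++ʷ A B)

  ++ʷ-comm : ∀ {X : Set} (f : ∀ {u v} → Walk u v → List X) →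
             (∀ {u m v} (A : Walk u m) (B : Walk m v) → f (A ++ʷ B) ≡ f A ++ f B) →
             ∀ {u v} (A : Walk u v) (B : Walk v u) → f (B ++ʷ A) ↭ f (A ++ʷ B)
  ++ʷ-comm f f-++ʷ A B = begin
    f (B ++ʷ A)   ≡⟨ f-++ʷ B A ⟩
    f B ++ f A    ↭⟨ ++-comm (f B) (f A) ⟩
    f A ++ f B    ≡⟨ f-++ʷ A B ⟨
    f (A ++ʷ B)   ∎
    where open PermutationReasoning

  splitAt : ∀ {u v a} (W : Walk u v) → a ∈ₗ anchors W → ∃₂ λ (A : Walk u a) (B : Walk a v) → W ≡ A ++ʷ B
  splitAt (step e s W) (here refl) = [] , step e s W , refl
  splitAt (step e s W) (there a∈W) with A , B , refl ← splitAt W a∈W = step e s A , B , refl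

  rotate : ∀ {u a} (W : Walk u u) → a ∈ₗ anchors W →
           Σ (Walk a a) λ R → edges R ↭ edges W × anchors R ↭ anchors W
  rotate W a∈W with A , B , refl ← splitAt W a∈W =
    B ++ʷ A , ++ʷ-comm edges edges-++ʷ A B , ++ʷ-comm anchors anchors-++ʷ A B

  record ClosedWalk : Set where
    constructor closedWalk
    field
      {base}   : Vertex
      walk     : Walk base base
      2≤length : 2 ≤ length (edges walk)

  open ClosedWalk public

  edgesOf : ClosedWalk → List Edge
  edgesOf T = edges (walk T)

  anchorsOf : ClosedWalk → List Vertex
  anchorsOf T = anchors (walk T)

  closedWalk-↭ : ∀ {a} (W : Walk a a) {xs} → edges W ↭ xs → 2 ≤ length xs → ClosedWalk
  closedWalk-↭ W W↭xs 2≤xs = closedWalk W (subst (2 ≤_) (sym (↭-length W↭xs)) 2≤xs)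

  record Splice (T S : ClosedWalk) : Set where
    field
      trail    : ClosedWalk
      edges↭   : edgesOf trail ↭ edgesOf T ++ edgesOf S
      anchors↭ : anchorsOf trail ↭ anchorsOf T ++ anchorsOf S

  splice : ∀ (T S : ClosedWalk) {a} → a ∈ₗ anchorsOf T → a ∈ₗ anchorsOf S → Splice T S
  splice T S a∈T a∈S
    with RT , RT-edges , RT-anchors ← rotate (walk T) a∈T
       | RS , RS-edges , RS-anchors ← rotate (walk S) a∈S
    = record
      { trail    = closedWalk-↭ (RT ++ʷ RS) edges↭
                     (≤-trans (2≤length T) (length-++-≤ˡ (edgesOf T)))
      ; edges↭   = edges↭
      ; anchors↭ = ↭-trans (↭-reflexive (anchors-++ʷ RT RS)) (↭.++⁺ RT-anchors RS-anchors)
      }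
    where
      edges↭ : edges (RT ++ʷ RS) ↭ edgesOf T ++ edgesOf S
      edges↭ = ↭-trans (↭-reflexive (edges-++ʷ RT RS)) (↭.++⁺ RT-edges RS-edges)

  familyEdges : List ClosedWalk → List Edge
  familyEdges = concatMap edgesOf

  familyAnchors : List ClosedWalk → List Vertex
  familyAnchors = concatMap anchorsOf

  AnchorDisjoint : ClosedWalk → ClosedWalk → Set
  AnchorDisjoint T S = Disjoint (anchorsOf T) (anchorsOf S)

  shareAnchor? : ∀ T S → (∃ λ a → a ∈ₗ anchorsOf T × a ∈ₗ anchorsOf S) ⊎ AnchorDisjoint T S
  shareAnchor? T S with Any.any? (λ a → DecMembership._∈?_ _≟_ a (anchorsOf S)) (anchorsOf T)
  ... | yes shared = inj₁ (find shared)
  ... | no ¬shared = inj₂ λ (a∈T , a∈S) → ¬shared (lose a∈T a∈S)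

  record Merge (T : ClosedWalk) (fam : List ClosedWalk) : Set where
    field
      trails   : List ClosedWalk
      disjoint : AllPairs AnchorDisjoint trails
      edges↭   : familyEdges trails ↭ edgesOf T ++ familyEdges fam
      anchors↭ : familyAnchors trails ↭ anchorsOf T ++ familyAnchors fam

  mergeInto : ∀ T fam → AllPairs AnchorDisjoint fam → Merge T fam
  mergeInto T [] [] = record { trails = T ∷ [] ; disjoint = [] ∷ [] ; edges↭ = ↭-refl ; anchors↭ = ↭-refl }
  mergeInto T (S ∷ fam) (S#fam ∷ fam#) with shareAnchor? T S
  ... | inj₁ (a , a∈T , a∈S) = record
    { trails   = M.trails
    ; disjoint = M.disjoint
    ; edges↭   = ↭-expand (edgesOf T) (edgesOf S) M.edges↭ J.edges↭
    ; anchors↭ = ↭-expand (anchorsOf T) (anchorsOf S) M.anchors↭ J.anchors↭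
    }
    where
      module J = Splice (splice T S a∈T a∈S)
      module M = Merge (mergeInto J.trail fam fam#)
  ... | inj₂ T#S = record
    { trails   = S ∷ M.trails
    ; disjoint = S#M ∷ M.disjoint
    ; edges↭   = ↭-trans (↭.++⁺ˡ (edgesOf S) M.edges↭) (shifts (edgesOf S) (edgesOf T))
    ; anchors↭ = ↭-trans (↭.++⁺ˡ (anchorsOf S) M.anchors↭) (shifts (anchorsOf S) (anchorsOf T))
    }
    where
      module M = Merge (mergeInto T fam fam#)
      -- The merged trails only use anchors of T and fam, all of which S avoids.
      S#M : All (AnchorDisjoint S) M.trails
      S#M = All.map⁻ (Disjoint-concat⁻ʳ (Disjoint-resp-↭ʳ (↭-sym M.anchors↭)
              (Disjoint-++⁺ʳ (anchorsOf T) (Disjoint.sym T#S) (Disjoint.concat⁺ʳ (All.map⁺ S#fam)))))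

  mergeAll : ∀ fam → Σ (List ClosedWalk) λ fam′ → AllPairs AnchorDisjoint fam′ × familyEdges fam′ ↭ familyEdges fam
  mergeAll []        = [] , [] , ↭-refl
  mergeAll (T ∷ fam) with fam′ , fam′# , fam′↭ ← mergeAll fam =
    let module M = Merge (mergeInto T fam′ fam′#) in
    M.trails , M.disjoint , ↭-trans M.edges↭ (↭.++⁺ˡ (edgesOf T) fam′↭)

  anchorAt : ∀ {u v} (W : Walk u v) → Fin (suc (length (edges W))) → Vertex
  anchorAt {u} W            zero    = u
  anchorAt     (step e s W) (suc i) = anchorAt W i

  anchorAt-step : ∀ {u v} (W : Walk u v) i →
                  Step (lookup (edges W) i) (anchorAt W (inject₁ i)) (anchorAt W (suc i))
  anchorAt-step (step e s W) zero    = s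
  anchorAt-step (step e s W) (suc i) = anchorAt-step W i

  anchorAt-last : ∀ {u v} (W : Walk u v) → anchorAt W (fromℕ (length (edges W))) ≡ v
  anchorAt-last []           = refl
  anchorAt-last (step e s W) = anchorAt-last W

  anchorAt-∈ : ∀ {u v} (W : Walk u v) i → anchorAt W i ∈ₗ anchors W ⊎ anchorAt W i ≡ v
  anchorAt-∈ []           zero    = inj₂ refl
  anchorAt-∈ (step e s W) zero    = inj₁ (here refl)
  anchorAt-∈ (step e s W) (suc i) with anchorAt-∈ W i
  ... | inj₁ ∈W = inj₁ (there ∈W)
  ... | inj₂ ≡v = inj₂ ≡v

  base∈anchorsOf : ∀ T → base T ∈ₗ anchorsOf T
  base∈anchorsOf (closedWalk (step e s W) _) = here refl

  anchorAt∈anchorsOf : ∀ T i → anchorAt (walk T) i ∈ₗ anchorsOf T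
  anchorAt∈anchorsOf T i with anchorAt-∈ (walk T) i
  ... | inj₁ ∈T    = ∈T
  ... | inj₂ ≡base = subst (_∈ₗ anchorsOf T) (sym ≡base) (base∈anchorsOf T)

  toClosedStrictTrail : ∀ T → Unique (edgesOf T) → ClosedStrictTrail H
  toClosedStrictTrail T unique = record
    { len    = length (edgesOf T)
    ; len≥2  = 2≤length T
    ; anchor = anchorAt (walk T)
    ; edgeAt = lookup (edgesOf T)
    ; step≢  = proj₁ ∘ anchorAt-step (walk T)
    ; step∈₁ = proj₁ ∘ proj₂ ∘ anchorAt-step (walk T)
    ; step∈₂ = proj₂ ∘ proj₂ ∘ anchorAt-step (walk T)
    ; closed = anchorAt-last (walk T)
    ; strict = λ i j → Unique⇒lookup-injective unique
    }

  -- Strictness of each trail and edge-disjointness of distinct trails are both carried by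
  -- the single condition that the concatenated edge list is duplicate-free.
  record TrailPacking : Set where
    constructor packing
    field
      trails : List ClosedWalk
      unique : Unique (familyEdges trails)

  open TrailPacking public

  Covered : TrailPacking → Edge → Set
  Covered P e = e ∈ₗ familyEdges (trails P)

  TrailDecomposition : Set
  TrailDecomposition = Σ TrailPacking λ P → ∀ e → Covered P e

  eulerFamily : (P : TrailPacking) → (∀ e → Covered P e) → AllPairs AnchorDisjoint (trails P) → EulerFamily H
  eulerFamily (packing fam unique) covered anchorDisjoint = record
    { size           = length fam
    ; trail          = λ a → toClosedStrictTrail (lookup fam a) (All.lookup trailsUnique (∈-lookup a))
    ; anchorDisjoint = λ a b a≢b i j anchorᵢ≡anchorⱼ → AllPairs-lookup Disjoint.sym anchorDisjoint a≢b
        (anchorAt∈anchorsOf (lookup fam a) i , subst (_∈ₗ anchorsOf (lookup fam b)) (sym anchorᵢ≡anchorⱼ) (anchorAt∈anchorsOf (lookup fam b) j))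
    ; covers         = λ e → let e∈fam = Any.concatMap⁻ edgesOf {xs = fam} (covered e) in
        Any.index e∈fam , ∈⇒∃lookup (Any.lookup-index e∈fam)
    ; unique         = inSameTrail
    }
    where
      trailsUnique : All (Unique ∘ edgesOf) fam
      trailsUnique = All.map⁻ (proj₁ (Unique-concat⁻ (map edgesOf fam) unique))

      edgeDisjoint : AllPairs (λ T S → Disjoint (edgesOf T) (edgesOf S)) fam
      edgeDisjoint = AllPairs.map⁻ (proj₂ (Unique-concat⁻ (map edgesOf fam) unique))

      inSameTrail : ∀ e a b → ∃ (λ i → lookup (edgesOf (lookup fam a)) i ≡ e) →
                    ∃ (λ j → lookup (edgesOf (lookup fam b)) j ≡ e) → a ≡ b
      inSameTrail e a b (i , eᵢ≡e) (j , eⱼ≡e) with a ≟ b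
      ... | yes a≡b = a≡b
      ... | no a≢b  = contradiction (subst (_∈ₗ _) eᵢ≡e (∈-lookup i) , subst (_∈ₗ _) eⱼ≡e (∈-lookup j))
                                    (AllPairs-lookup Disjoint.sym edgeDisjoint a≢b)

  quasiEulerian : TrailDecomposition → QuasiEulerian H
  quasiEulerian (P , covered) with fam , anchorDisjoint , fam↭ ← mergeAll (trails P) =
    eulerFamily (packing fam (Unique-resp-↭ (↭-sym fam↭) (unique P)))
                (λ e → ∈-resp-↭ (↭-sym fam↭) (covered e)) anchorDisjoint

-- Absorbing an edge along an arc of D₃(H)

module D₃Walks (H : Hypergraph) where
  open Hypergraph H
  open Walks H

  subdivide : ∀ {e f u w} → D₃-arc H e f → Step f u w →
              ∃ λ x → (Step e u x × Step f x w) ⊎ (Step f u x × Step e x w)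
  subdivide {e} {f} {u} {w} (∣f─e∣≡1 , 3≤∣e∩f∣) (u≢w , u∈f , w∈f)
    with x , x∈e∩f , x∉uw ← length<∣p∣⇒∃x∈p∉xs (edge e ∩ edge f) (u ∷ w ∷ []) 3≤∣e∩f∣
    with x∈e , x∈f ← x∈p∩q⁻ (edge e) (edge f) x∈e∩f
    with u≢x , x≢w ← (x∉uw ∘ Any.here ∘ sym , x∉uw ∘ Any.there ∘ Any.here)
    with ∣q─p∣≡1⇒x∈p⊎y∈p ∣f─e∣≡1 u≢w u∈f w∈f
  ... | inj₁ u∈e = x , inj₁ ((u≢x , u∈e , x∈e) , (x≢w , x∈f , w∈f))
  ... | inj₂ w∈e = x , inj₂ ((u≢x , u∈f , x∈f) , (x≢w , x∈e , w∈e))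

  digonSteps : ∀ {e f} → D₃-arc H e f → ∃₂ λ u w → Step f u w × Step e w u
  digonSteps {e} {f} (_ , 3≤∣e∩f∣)
    with u , u∈e∩f , _   ← length<∣p∣⇒∃x∈p∉xs (edge e ∩ edge f) [] (≤-trans (s≤s z≤n) 3≤∣e∩f∣)
    with w , w∈e∩f , w∉u ← length<∣p∣⇒∃x∈p∉xs (edge e ∩ edge f) (u ∷ []) (≤-trans (s≤s (s≤s z≤n)) 3≤∣e∩f∣)
    with u∈e , u∈f ← x∈p∩q⁻ (edge e) (edge f) u∈e∩f
    with w∈e , w∈f ← x∈p∩q⁻ (edge e) (edge f) w∈e∩f
    with u≢w ← w∉u ∘ Any.here ∘ sym
    = u , w , (u≢w , u∈f , w∈f) , (≢-sym u≢w , w∈e , u∈e)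

  digon : ∀ {e f} → D₃-arc H e f → ClosedWalk
  digon {e} {f} arc =
    let _ , _ , u→w , w→u = digonSteps arc in
    closedWalk (step f u→w (step e w→u [])) (s≤s (s≤s z≤n))

  insertBeside : ∀ {e f u v} → D₃-arc H e f → (W : Walk u v) → f ∈ₗ edges W →
                 Σ (Walk u v) λ W′ → edges W′ ↭ e ∷ edges W
  insertBeside {e} arc (step f s W) (here refl) with subdivide arc s
  ... | _ , inj₁ (u→x , x→w) = step e u→x (step f x→w W) , ↭-refl
  ... | _ , inj₂ (u→x , x→w) = step f u→x (step e x→w W) , ↭-swap f e ↭-refl
  insertBeside {e} arc (step g s W) (there f∈W) with W′ , W′↭ ← insertBeside arc W f∈W =
    step g s W′ , ↭-trans (↭-prep g W′↭) (↭-swap g e ↭-refl)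

  insertIntoFamily : ∀ {e f} → D₃-arc H e f → (fam : List ClosedWalk) → f ∈ₗ familyEdges fam →
                     Σ (List ClosedWalk) λ fam′ → familyEdges fam′ ↭ e ∷ familyEdges fam
  insertIntoFamily {e} arc (T ∷ fam) f∈ with ∈-++⁻ (edgesOf T) f∈
  ... | inj₁ f∈T with W′ , W′↭ ← insertBeside arc (walk T) f∈T =
    closedWalk-↭ W′ W′↭ (m≤n⇒m≤1+n (2≤length T)) ∷ fam , ↭.++⁺ʳ (familyEdges fam) W′↭
  ... | inj₂ f∈fam with fam′ , fam′↭ ← insertIntoFamily arc fam f∈fam =
    T ∷ fam′ , ↭-trans (↭.++⁺ˡ (edgesOf T) fam′↭) (↭.shift e (edgesOf T) (familyEdges fam))

-- Covering E along the forest

module ForestDecomposition (H : Hypergraph) (F : SpanningArborescenceForest H) where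
  open Hypergraph H
  open SpanningArborescenceForest F
  open Walks H
  open D₃Walks H

  infix 4 _⇾_ _⊑_

  _⇾_ : Edge → Edge → Set
  c ⇾ r = T (arc c r)

  IsRoot : Edge → Set
  IsRoot e = ¬ ∃ (e ⇾_)

  parent? : ∀ e → Dec (∃ (e ⇾_))
  parent? e = any? λ f → T? (arc e f)

  ⇾-irreflexive : ∀ {e f} → e ⇾ f → e ≢ f
  ⇾-irreflexive {e} e⇾e refl = acyclic e [ e⇾e ]

  covered? : ∀ P e → Dec (Covered P e)
  covered? P e = DecMembership._∈?_ _≟_ e (familyEdges (trails P))

  _⊑_ : TrailPacking → TrailPacking → Set
  P ⊑ P′ = Covered P ⊆ Covered P′

  record Extension (P : TrailPacking) (xs : List Edge) : Set where
    field
      extended : TrailPacking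
      edges↭   : familyEdges (trails extended) ↭ xs ++ familyEdges (trails P)

    new-covered : ∀ {x} → x ∈ₗ xs → Covered extended x
    new-covered x∈xs = ∈-resp-↭ (↭-sym edges↭) (∈-++⁺ˡ x∈xs)

    ⊑-extended : P ⊑ extended
    ⊑-extended x∈P = ∈-resp-↭ (↭-sym edges↭) (∈-++⁺ʳ xs x∈P)

    covered⁻ : ∀ {x} → Covered extended x → x ∈ₗ xs ⊎ Covered P x
    covered⁻ x∈ = ∈-++⁻ xs (∈-resp-↭ edges↭ x∈)

  addDigon : ∀ {c r} P → c ⇾ r → ¬ Covered P r → ¬ Covered P c → Extension P (r ∷ c ∷ [])
  addDigon P c⇾r r∉P c∉P = record
    { extended = packing (digon (arc⊆D₃ c⇾r) ∷ trails P)
                         ((≢-sym (⇾-irreflexive c⇾r) ∷ All.¬Any⇒All¬ _ r∉P) ∷ All.¬Any⇒All¬ _ c∉P ∷ unique P)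
    ; edges↭   = ↭-refl
    }

  addChild : ∀ {c r} P → c ⇾ r → Covered P r → ¬ Covered P c → Extension P (c ∷ [])
  addChild P c⇾r r∈P c∉P with fam′ , fam′↭ ← insertIntoFamily (arc⊆D₃ c⇾r) (trails P) r∈P = record
    { extended = packing fam′ (Unique-resp-↭ (↭-sym fam′↭) (All.¬Any⇒All¬ _ c∉P ∷ unique P))
    ; edges↭   = fam′↭
    }

  sweep : (Inv : TrailPacking → Set) (Goal : Edge → Set) →
          (∀ e P → Inv P → Σ TrailPacking λ P′ → Inv P′ × P ⊑ P′ × (Goal e → Covered P′ e)) →
          ∀ xs P → Inv P → Σ TrailPacking λ P′ → P ⊑ P′ × (∀ {e} → e ∈ₗ xs → Goal e → Covered P′ e)
  sweep Inv Goal handle []       P inv = P , id , λ ()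
  sweep Inv Goal handle (x ∷ xs) P inv
    with P₁ , inv₁ , P⊑P₁ , x-done ← handle x P inv
    with P₂ , P₁⊑P₂ , xs-done ← sweep Inv Goal handle xs P₁ inv₁
    = P₂ , P₁⊑P₂ ∘ P⊑P₁ , λ where
        (here refl) → P₁⊑P₂ ∘ x-done
        (there e∈xs) → xs-done e∈xs

  -- Invariant of the sweep over the roots: an uncovered root has no covered child, so a
  -- digon with any of its children can be added.
  UpClosed : TrailPacking → Set
  UpClosed P = ∀ {x f} → x ⇾ f → Covered P x → Covered P f

  coverRoot : ∀ r P → UpClosed P → Σ TrailPacking λ P′ → UpClosed P′ × P ⊑ P′ × (IsRoot r → Covered P′ r)
  coverRoot r P up with covered? P r | parent? r
  ... | yes r∈P | _             = P , up , id , const r∈P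
  ... | no _    | yes hasParent = P , up , id , contradiction hasParent
  ... | no r∉P  | no root with nontrivial r
  ...   | inj₁ hasParent = contradiction hasParent root
  ...   | inj₂ (c , c⇾r) = X.extended , up′ , X.⊑-extended , const (X.new-covered (here refl))
    where
      module X = Extension (addDigon P c⇾r r∉P (r∉P ∘ up c⇾r))
      up′ : UpClosed X.extended
      up′ x⇾f x∈ with X.covered⁻ x∈
      ... | inj₁ (here refl)         = contradiction (_ , x⇾f) root
      ... | inj₁ (there (here refl)) = X.new-covered (here (outdeg≤1 x⇾f c⇾r))
      ... | inj₂ x∈P                 = X.⊑-extended (up x⇾f x∈P)

  coverNonRoot : ∀ e P → ⊤ → Σ TrailPacking λ P′ → ⊤ × P ⊑ P′ × (¬ IsRoot e → Covered P′ e)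
  coverNonRoot e P _ with covered? P e | parent? e
  ... | yes e∈P | _             = P , tt , id , const e∈P
  ... | no _    | no root       = P , tt , id , λ nonRoot → contradiction root nonRoot
  ... | no e∉P  | yes (f , e⇾f) with covered? P f
  ...   | yes f∈P = X.extended , tt , X.⊑-extended , const (X.new-covered (here refl))
    where module X = Extension (addChild P e⇾f f∈P e∉P)
  ...   | no f∉P  = X.extended , tt , X.⊑-extended , const (X.new-covered (there (here refl)))
    where module X = Extension (addDigon P e⇾f f∉P e∉P)

  decomposition : TrailDecomposition
  decomposition
    with P₁ , _ , roots ← sweep UpClosed IsRoot coverRoot (allFin nE) (packing [] []) (λ _ ())
    with P₂ , P₁⊑P₂ , nonRoots ← sweep (λ _ → ⊤) (¬_ ∘ IsRoot) coverNonRoot (allFin nE) P₁ tt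
    = P₂ , λ e → rootOrNot e (P₁⊑P₂ ∘ roots (∈-allFin e)) (nonRoots (∈-allFin e))
    where
      rootOrNot : ∀ {A : Set} e → (IsRoot e → A) → (¬ IsRoot e → A) → A
      rootOrNot e root nonRoot with parent? e
      ... | yes hasParent = nonRoot (λ isRoot → isRoot hasParent)
      ... | no isRoot     = root isRoot

mainTheorem4 : (H : Hypergraph) → SpanningArborescenceForest H → QuasiEulerian H
mainTheorem4 H F = Walks.quasiEulerian H (ForestDecomposition.decomposition H F)
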